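{- For every $n\geq 0$, $T_n \in P(T_{n+1}, 2^n\times 2^n)$.
   Context: Let $\mathcal{A}=\{\mathtt{A},\dots,\mathtt{P}\}$. The substitution $\mu$ maps each letter to a $2\times2$ block over $\mathcal{A}$ (written (first row / second row)): $\mathtt{A}\mapsto(\mathtt{AF}/\mathtt{GC})$, $\mathtt{B}\mapsto(\mathtt{AF}/\mathtt{HD})$, $\mathtt{C}\mapsto(\mathtt{BE}/\mathtt{GC})$, $\mathtt{D}\mapsto(\mathtt{BE}/\mathtt{HD})$, $\mathtt{E}\mapsto(\mathtt{AN}/\mathtt{GK})$, $\mathtt{F}\mapsto(\mathtt{AN}/\mathtt{HL})$, $\mathtt{G}\mapsto(\mathtt{BM}/\mathtt{GK})$, $\mathtt{H}\mapsto(\mathtt{BM}/\mathtt{HL})$, $\mathtt{I}\mapsto(\mathtt{IF}/\mathtt{OC})$, $\mathtt{J}\mapsto(\mathtt{IF}/\mathtt{PD})$, $\mathtt{K}\mapsto(\mathtt{JE}/\mathtt{OC})$, $\mathtt{L}\mapsto(\mathtt{JE}/\mathtt{PD})$, $\mathtt{M}\mapsto(\mathtt{IN}/\mathtt{OK})$, $\mathtt{N}\mapsto(\mathtt{IN}/\mathtt{PL})$, $\mathtt{O}\mapsto(\mathtt{JM}/\mathtt{OK})$, $\mathtt{P}\mapsto(\mathtt{JM}/\mathtt{PL})$. For a matrix $X$ over $\mathcal{A}$, $\mu(X)$ replaces each entry by its $2\times2$ block; $\mu^0=\mathrm{id}$, $\mu^k=\mu^{k-1}\circ\mu$. $T_n:=\mu^n(\mathtt{N})$.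 For a matrix $X$, $P(X,m\times n)$ denotes the set of all $m\times n$ contiguous submatrices of $X$. -}

module Defs where

open import Data.Nat using (ℕ; zero; suc; _*_; _+_; _≤_; _<?_)
open import Data.Fin using (Fin; zero; suc; remQuot; toℕ; fromℕ<)
open import Data.Product using (Σ; _×_; _,_; ∃)
open import Data.Maybe using (Maybe; just; nothing)
open import Relation.Binary.PropositionalEquality using (_≡_)
open import Relation.Nullary using (yes; no)

data Letter : Set where
  A B C D E F G H I J K L M N O P : Letter

-- An m × n matrix over the alphabet (rows indexed first)
Mat : ℕ → ℕ → Set
Mat m n = Fin m → Fin n → Letter

blk : Letter → Letter → Letter → Letter → Mat 2 2
blk x y z w zero    zero       = x
blk x y z w zero    (suc zero) = y
blk x y z w (suc zero) zero    = z
blk x y z w (suc zero) (suc zero) = w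

σ : Letter → Mat 2 2
σ A = blk A F G C
σ B = blk A F H D
σ C = blk B E G C
σ D = blk B E H D
σ E = blk A N G K
σ F = blk A N H L
σ G = blk B M G K
σ H = blk B M H L
σ I = blk I F O C
σ J = blk I F P D
σ K = blk J E O C
σ L = blk J E P D
σ M = blk I N O K
σ N = blk I N P L
σ O = blk J M O K
σ P = blk J M P L

μ : ∀ {m n} → Mat m n → Mat (m * 2) (n * 2)
μ {m} {n} X r c with remQuot {m} 2 r | remQuot {n} 2 c
... | (r₁ , r₂) | (c₁ , c₂) = σ (X r₁ c₁) r₂ c₂

dim : ℕ → ℕ → ℕ
dim zero    m = m
dim (suc k) m = dim k (m * 2)

μ^ : ∀ k {m n} → Mat m n → Mat (dim k m) (dim k n)
μ^ zero    X = X
μ^ (suc k) X = μ^ k (μ X)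

single : Letter → Mat 1 1
single x _ _ = x

-- T_n = μ^n(N), a 2^n × 2^n matrix (dim n 1 = 2^n)
T : (n : ℕ) → Mat (dim n 1) (dim n 1)
T n = μ^ n (single N)

at : ∀ {m n} → Mat m n → ℕ → ℕ → Maybe Letter
at {m} {n} X i j with i <? m | j <? n
... | yes i<m | yes j<n = just (X (fromℕ< i<m) (fromℕ< j<n))
... | _       | _       = nothing

-- Y ∈ P(X, p × q): Y (a p × q matrix) is a contiguous submatrix of X,
-- i.e. it occurs at some offset (i, j) fully inside X.
_∈P_ : ∀ {p q m n} → Mat p q → Mat m n → Set
_∈P_ {p} {q} {m} {n} Y X =
  Σ ℕ λ i → Σ ℕ λ j → (i + p ≤ m) × (j + q ≤ n) ×
    (∀ (a : Fin p) (b : Fin q) → at X (i + toℕ a) (j + toℕ b) ≡ just (Y a b))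

-- If Y occurs in X at offset (i, j), then μ(Y) occurs in μ(X) at offset (2i, 2j), since μ replaces
-- every letter by the same 2×2 block wherever it stands. Hence occurrences propagate along μ^n,
-- and it suffices that N occurs in μ(N) = (IN/PL), at offset (0, 1).
module Submission where

open import Defs
open import Data.Nat using (ℕ; suc; zero; _+_; _*_; _≤_; _<?_; s≤s; z≤n)
open import Data.Nat.Properties using (*-monoˡ-≤; *-comm; *-distribʳ-+; *-distribˡ-+; +-assoc)
open import Data.Fin using (Fin; zero; toℕ; fromℕ<; remQuot; combine)
open import Data.Fin.Properties
  using (fromℕ<-toℕ; toℕ-fromℕ<; toℕ<n; remQuot-combine; combine-remQuot; toℕ-combine)
open import Data.Product using (Σ; _×_; _,_; proj₁; proj₂)
open import Data.Maybe using (just)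
open import Relation.Binary.PropositionalEquality
open import Relation.Nullary using (yes; no; contradiction)

at-toℕ : ∀ {m n} (X : Mat m n) (r : Fin m) (c : Fin n) → at X (toℕ r) (toℕ c) ≡ just (X r c)
at-toℕ {m} {n} X r c with toℕ r <? m | toℕ c <? n
... | yes r<m | yes c<n = cong just (cong₂ X (fromℕ<-toℕ r r<m) (fromℕ<-toℕ c c<n))
... | no r≮m  | _       = contradiction (toℕ<n r) r≮m
... | yes _   | no c≮n  = contradiction (toℕ<n c) c≮n

at≡just⇒ : ∀ {m n} (X : Mat m n) (i j : ℕ) {x : Letter} → at X i j ≡ just x →
  Σ (Fin m) λ r → Σ (Fin n) λ c → toℕ r ≡ i × toℕ c ≡ j × X r c ≡ x
at≡just⇒ {m} {n} X i j eq with i <? m | j <? n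
at≡just⇒ X i j refl | yes i<m | yes j<n = fromℕ< i<m , fromℕ< j<n , toℕ-fromℕ< i<m , toℕ-fromℕ< j<n , refl
at≡just⇒ X i j ()   | yes _   | no _
at≡just⇒ X i j ()   | no _    | _

μ-combine : ∀ {m n} (X : Mat m n) (r : Fin m) (a : Fin 2) (c : Fin n) (b : Fin 2) →
  μ X (combine r a) (combine c b) ≡ σ (X r c) a b
μ-combine {m} {n} X r a c b =
  cong₂ (λ (r₁ , r₂) (c₁ , c₂) → σ (X r₁ c₁) r₂ c₂)
        (remQuot-combine {m} {2} r a) (remQuot-combine {n} {2} c b)

combine-elim : ∀ {p q} (Q : Fin (p * 2) → Fin (q * 2) → Set) →
  (∀ a₁ a₂ b₁ b₂ → Q (combine a₁ a₂) (combine b₁ b₂)) → ∀ a b → Q a b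
combine-elim {p} {q} Q h a b =
  subst₂ Q (combine-remQuot {p} 2 a) (combine-remQuot {q} 2 b)
    (h (proj₁ (remQuot {p} 2 a)) (proj₂ (remQuot {p} 2 a))
       (proj₁ (remQuot {q} 2 b)) (proj₂ (remQuot {q} 2 b)))

doubled-offset-≤ : ∀ i p m → i + p ≤ m → 2 * i + p * 2 ≤ m * 2
doubled-offset-≤ i p m i+p≤m = subst (_≤ m * 2) distrib (*-monoˡ-≤ 2 i+p≤m)
  where
  distrib : (i + p) * 2 ≡ 2 * i + p * 2
  distrib = trans (*-distribʳ-+ 2 i p) (cong (_+ p * 2) (*-comm i 2))

toℕ-combine-shift : ∀ {m p} i (r : Fin m) (a₁ : Fin p) (a₂ : Fin 2) → toℕ r ≡ i + toℕ a₁ →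
  2 * i + toℕ (combine a₁ a₂) ≡ toℕ (combine r a₂)
toℕ-combine-shift i r a₁ a₂ r≡i+a₁ = begin
  2 * i + toℕ (combine a₁ a₂)     ≡⟨ cong (2 * i +_) (toℕ-combine a₁ a₂) ⟩
  2 * i + (2 * toℕ a₁ + toℕ a₂)   ≡⟨ +-assoc (2 * i) (2 * toℕ a₁) (toℕ a₂) ⟨
  2 * i + 2 * toℕ a₁ + toℕ a₂     ≡⟨ cong (_+ toℕ a₂) (*-distribˡ-+ 2 i (toℕ a₁)) ⟨
  2 * (i + toℕ a₁) + toℕ a₂       ≡⟨ cong (λ k → 2 * k + toℕ a₂) r≡i+a₁ ⟨
  2 * toℕ r + toℕ a₂              ≡⟨ toℕ-combine r a₂ ⟨
  toℕ (combine r a₂)              ∎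
  where open ≡-Reasoning

μ-preserves-∈P : ∀ {p q m n} {Y : Mat p q} {X : Mat m n} → Y ∈P X → μ Y ∈P μ X
μ-preserves-∈P {p} {q} {m} {n} {Y} {X} (i , j , i+p≤m , j+q≤n , occ) =
  2 * i , 2 * j , doubled-offset-≤ i p m i+p≤m , doubled-offset-≤ j q n j+q≤n ,
  combine-elim (λ a b → at (μ X) (2 * i + toℕ a) (2 * j + toℕ b) ≡ just (μ Y a b)) occ-μ
  where
  occ-μ : ∀ a₁ a₂ b₁ b₂ → at (μ X) (2 * i + toℕ (combine a₁ a₂)) (2 * j + toℕ (combine b₁ b₂))
                          ≡ just (μ Y (combine a₁ a₂) (combine b₁ b₂))
  occ-μ a₁ a₂ b₁ b₂ with at≡just⇒ X _ _ (occ a₁ b₁)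
  ... | r , c , r≡i+a₁ , c≡j+b₁ , Xrc≡Ya₁b₁ = begin
    at (μ X) (2 * i + toℕ (combine a₁ a₂)) (2 * j + toℕ (combine b₁ b₂))
      ≡⟨ cong₂ (at (μ X)) (toℕ-combine-shift i r a₁ a₂ r≡i+a₁) (toℕ-combine-shift j c b₁ b₂ c≡j+b₁) ⟩
    at (μ X) (toℕ (combine r a₂)) (toℕ (combine c b₂))
      ≡⟨ at-toℕ (μ X) (combine r a₂) (combine c b₂) ⟩
    just (μ X (combine r a₂) (combine c b₂))
      ≡⟨ cong just (μ-combine X r a₂ c b₂) ⟩
    just (σ (X r c) a₂ b₂)
      ≡⟨ cong (λ x → just (σ x a₂ b₂)) Xrc≡Ya₁b₁ ⟩
    just (σ (Y a₁ b₁) a₂ b₂)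
      ≡⟨ cong just (μ-combine Y a₁ a₂ b₁ b₂) ⟨
    just (μ Y (combine a₁ a₂) (combine b₁ b₂)) ∎
    where open ≡-Reasoning

μ^-preserves-∈P : ∀ k {p q m n} {Y : Mat p q} {X : Mat m n} → Y ∈P X → μ^ k Y ∈P μ^ k X
μ^-preserves-∈P zero    Y∈PX = Y∈PX
μ^-preserves-∈P (suc k) Y∈PX = μ^-preserves-∈P k (μ-preserves-∈P Y∈PX)

N∈Pμ-N : single N ∈P μ (single N)
N∈Pμ-N = 0 , 1 , s≤s z≤n , s≤s (s≤s z≤n) , λ { zero zero → refl }

lemma1 : (n : ℕ) → T n ∈P T (suc n)
lemma1 n = μ^-preserves-∈P n N∈Pμ-N
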